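{- Let $(S,\mathcal B)$ be a Steiner triple system of order $21$ and let $A,B,C,D$ be a partition of $S$ with $|A|=|B|=|C|=6$, $|D|=3$. Then $\{A,B,C,D\}$ is a flower with stem $D$ if and only if $\mathcal B$ contains a sub-TD$(3,6)$ with groups $A,B,C$.
   Context: A Steiner triple system (STS) on $S$ is a set of 3-subsets (blocks) of $S$ such that any two distinct points lie in exactly one block; STS$(v)$ means $|S|=v$. A sub-STS$(9)$ of $\mathcal B$ is a subset of $\mathcal B$ forming an STS$(9)$ on some 9-set (its support). An almost-sub-STS of $\mathcal B$ is a subset of the form $\mathcal C'\setminus\{T\}$ where $\mathcal C'$ is an STS on some set (the support) and $T\in\mathcal C'$ (the missing triple, not necessarily in $\mathcal B$). A TD$(3,6)$ with groups $A,B,C$ (disjoint 6-sets) is a set of 3-subsets each meeting each group in one point such that any two points from different groups lie in exactly one of them; a sub-TD$(3,6)$ of $\mathcal B$ is such a set contained in $\mathcal B$. For an STS$(21)$ $(S,\mathcal B)$, a partition of $S$ into sets $A,B,C,D$ of sizes $6,6,6,3$ is a flower with stem $D$ and petals $A,B,C$ if $\mathcal B$ contains one sub-STS$(9)$ and two almost-sub-STS$(9)$ whose supports are $A\cup D$, $B\cup D$, $C\cup D$ (in some order), where the missing triple of each of these two almost-sub-STS is $D$ (whether or not $D\in\mathcal B$). -}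

module Defs where

open import Level using (Level; suc; zero)
open import Data.Nat using (ℕ)
open import Data.Fin using (Fin)
open import Data.Fin.Subset using (Subset; _∈_; _⊆_; _∩_; _∪_; ∣_∣; ⊤; ⊥)
open import Data.Product using (Σ; _×_; ∃!)
open import Data.Sum using (_⊎_)
open import Relation.Binary.PropositionalEquality using (_≡_; _≢_)

-- A block is a subset of the point set Fin n; a family of blocks is a
-- (proof-relevant) predicate on subsets.
Family : ℕ → Set₁
Family n = Subset n → Set

_⊑_ : ∀ {n} → Family n → Family n → Set
𝒞 ⊑ 𝓑 = ∀ b → 𝒞 b → 𝓑 b

IsSTSOn : ∀ {n} → Subset n → Family n → Set
IsSTSOn X 𝒞 =
  (∀ b → 𝒞 b → (∣ b ∣ ≡ 3) × (b ⊆ X)) ×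
  (∀ x y → x ∈ X → y ∈ X → x ≢ y →
     ∃! _≡_ (λ b → 𝒞 b × (x ∈ b) × (y ∈ b)))

IsSTS : (v : ℕ) → Family v → Set
IsSTS v 𝓑 = IsSTSOn ⊤ 𝓑

HasSubSTS9 : ∀ {n} → Family n → Subset n → Set₁
HasSubSTS9 𝓑 X = (∣ X ∣ ≡ 9) × Σ (Family _) (λ 𝒞 → (𝒞 ⊑ 𝓑) × IsSTSOn X 𝒞)

-- 𝓑 contains an almost-sub-STS(9) 𝒞' ∖ {T} with support X and missing
-- triple T (T need not be in 𝓑)
HasAlmostSubSTS9 : ∀ {n} → Family n → Subset n → Subset n → Set₁
HasAlmostSubSTS9 𝓑 X T =
  (∣ X ∣ ≡ 9) × Σ (Family _) (λ 𝒞' →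
    IsSTSOn X 𝒞' × 𝒞' T × (∀ b → 𝒞' b → b ≢ T → 𝓑 b))

IsPartition6663 : ∀ {n} → (A B C D : Subset n) → Set
IsPartition6663 A B C D =
  (A ∩ B ≡ ⊥) × (A ∩ C ≡ ⊥) × (A ∩ D ≡ ⊥) ×
  (B ∩ C ≡ ⊥) × (B ∩ D ≡ ⊥) × (C ∩ D ≡ ⊥) ×
  (A ∪ B ∪ C ∪ D ≡ ⊤) ×
  (∣ A ∣ ≡ 6) × (∣ B ∣ ≡ 6) × (∣ C ∣ ≡ 6) × (∣ D ∣ ≡ 3)

FlowerShape : ∀ {n} → Family n → (P Q R D : Subset n) → Set₁
FlowerShape 𝓑 P Q R D =
  HasSubSTS9 𝓑 (P ∪ D) × HasAlmostSubSTS9 𝓑 (Q ∪ D) D × HasAlmostSubSTS9 𝓑 (R ∪ D) D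

IsFlower : ∀ {n} → Family n → (A B C D : Subset n) → Set₁
IsFlower 𝓑 A B C D =
  FlowerShape 𝓑 A B C D ⊎ FlowerShape 𝓑 B A C D ⊎ FlowerShape 𝓑 C A B D

DiffGroups : ∀ {n} → (A B C : Subset n) → Fin n → Fin n → Set
DiffGroups A B C x y =
  ((x ∈ A) × (y ∈ B)) ⊎ ((x ∈ B) × (y ∈ A)) ⊎
  ((x ∈ A) × (y ∈ C)) ⊎ ((x ∈ C) × (y ∈ A)) ⊎
  ((x ∈ B) × (y ∈ C)) ⊎ ((x ∈ C) × (y ∈ B))

IsTD36 : ∀ {n} → (A B C : Subset n) → Family n → Set
IsTD36 A B C 𝒯 =
  (∣ A ∣ ≡ 6) × (∣ B ∣ ≡ 6) × (∣ C ∣ ≡ 6) ×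
  (A ∩ B ≡ ⊥) × (A ∩ C ≡ ⊥) × (B ∩ C ≡ ⊥) ×
  (∀ b → 𝒯 b → (∣ b ∣ ≡ 3) × (∣ b ∩ A ∣ ≡ 1) × (∣ b ∩ B ∣ ≡ 1) × (∣ b ∩ C ∣ ≡ 1)) ×
  (∀ x y → DiffGroups A B C x y → ∃! _≡_ (λ b → 𝒯 b × (x ∈ b) × (y ∈ b)))

HasSubTD36 : ∀ {n} → Family n → (A B C : Subset n) → Set₁
HasSubTD36 𝓑 A B C = Σ (Family _) (λ 𝒯 → (𝒯 ⊑ 𝓑) × IsTD36 A B C 𝒯)

-- Write x · y for the third point of the block through x ≠ y, and x · x = x: this Steiner
-- quasigroup is commutative and satisfies x · (x · y) = y. Both sides of the equivalence are
-- equivalent to every petal P being closed: x ∈ P and y ∈ P ∪ D imply x · y ∈ P ∪ D.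
-- A flower gives this through its (almost) sub-STS(9) on P ∪ D. Closed petals force x · y
-- into the third group whenever x and y lie in different groups, so the blocks meeting two
-- groups form a TD(3,6); conversely, given the TD, if x ∈ P and x · y fell into another group
-- then y = x · (x · y) would lie in the third one. To build the flower from closed petals it
-- remains to place the blocks through two points of the stem D = {d₁, d₂, d₃}. If d₁ · d₂ ∈ D
-- then D is a block. Otherwise d₁ · d₂ lies in some petal P, and then so does d · e for all
-- distinct d, e ∈ D: if d · e ∈ P but d · f ∉ P, then x ↦ d · x would be a fixed-point-free
-- involution of the five points of P ∖ {d · e}. That petal carries the sub-STS(9), the other
-- two the almost-sub-STS(9) missing D.

module Submission where

open import Data.Fin using (Fin; zero; suc)
open import Data.Fin.Properties using (_≟_)
open import Data.Fin.Subset
  using (Subset; _∈_; _∉_; _⊆_; _∩_; _∪_; _─_; _-_; ∣_∣; ⊥; ⁅_⁆; Nonempty; inside; outside)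
open import Data.Fin.Subset.Properties
  using (_∈?_; ∉⊥; ∈⊤; Empty-unique; x∈⁅x⁆; x∈⁅y⁆⇒x≡y; ∣⁅x⁆∣≡1; ⊆-antisym; p⊂q⇒∣p∣<∣q∣;
         p─⊥≡p; p─q⊆p; x∈p∧x≢y⇒x∈p-y; x∈p∩q⁺; x∈p∩q⁻; x∈p∪q⁻; p⊆p∪q; q⊆p∪q)
open import Data.Nat using (ℕ; zero; suc; _+_; _≤_)
open import Data.Nat.Divisibility using (_∣_; divides; _∣0; ∣-refl; ∣m∣n⇒∣m+n; ∣m+n∣m⇒∣n; ∣1⇒≡1)
open import Data.Nat.Properties using (suc-injective; 1+n≢0; +-comm; +-suc; <⇒≱; ≤-reflexive)
open import Data.Product using (∃; ∃!; _×_; _,_; proj₁; proj₂)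
open import Data.Sum using (_⊎_; inj₁; inj₂; map₂)
open import Data.Vec using ([]; _∷_; here; there)
open import Function.Base using (_∘_; case_of_)
open import Function.Bundles using (_⇔_; mk⇔)
open import Relation.Nullary using (¬_; Dec; yes; no; contradiction)
open import Relation.Binary.PropositionalEquality
  using (_≡_; _≢_; refl; sym; trans; cong; cong₂; subst)

open import Defs

private
  variable
    n k : ℕ
    p q r : Subset n
    x y z w : Fin n

Disjoint : Subset n → Subset n → Set
Disjoint p q = ∀ {x} → x ∈ p → x ∉ q

∩≡⊥⇒Disjoint : p ∩ q ≡ ⊥ → Disjoint p q
∩≡⊥⇒Disjoint p∩q≡⊥ x∈p x∈q = ∉⊥ (subst (_ ∈_) p∩q≡⊥ (x∈p∩q⁺ (x∈p , x∈q)))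

Disjoint-sym : Disjoint p q → Disjoint q p
Disjoint-sym p#q x∈q x∈p = p#q x∈p x∈q

Disjoint-∪ : Disjoint p q → Disjoint p r → Disjoint p (q ∪ r)
Disjoint-∪ {q = q} p#q p#r x∈p x∈q∪r with x∈p∪q⁻ q _ x∈q∪r
... | inj₁ x∈q = p#q x∈p x∈q
... | inj₂ x∈r = p#r x∈p x∈r

Disjoint⇒≢ : Disjoint p q → x ∈ p → y ∈ q → x ≢ y
Disjoint⇒≢ p#q x∈p y∈q refl = p#q x∈p y∈q

Disjoint-tail : ∀ {s t} → Disjoint (s ∷ p) (t ∷ q) → Disjoint p q
Disjoint-tail p#q x∈p x∈q = p#q (there x∈p) (there x∈q)

Disjoint⇒∩≡⊥ : Disjoint p q → p ∩ q ≡ ⊥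
Disjoint⇒∩≡⊥ {p = p} {q = q} p#q =
  Empty-unique (λ (x , x∈p∩q) → let (x∈p , x∈q) = x∈p∩q⁻ p q x∈p∩q in p#q x∈p x∈q)

x∈p─q⇒x∉q : x ∈ p ─ q → x ∉ q
x∈p─q⇒x∉q {p = _ ∷ _} {q = outside ∷ _} here        ()
x∈p─q⇒x∉q {p = _ ∷ _} {q = _ ∷ _}       (there x∈) (there x∈q) = x∈p─q⇒x∉q x∈ x∈q

x∈p-y⇒x≢y : x ∈ p - y → x ≢ y
x∈p-y⇒x≢y x∈p-y refl = x∈p─q⇒x∉q x∈p-y (x∈⁅x⁆ _)

∣p∣≡1+∣p-x∣ : x ∈ p → ∣ p ∣ ≡ suc ∣ p - x ∣
∣p∣≡1+∣p-x∣ {p = inside ∷ p} here = cong (suc ∘ ∣_∣) (sym (p─⊥≡p p))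
∣p∣≡1+∣p-x∣ {p = inside ∷ _} (there x∈p) = cong suc (∣p∣≡1+∣p-x∣ x∈p)
∣p∣≡1+∣p-x∣ {p = outside ∷ _} (there x∈p) = ∣p∣≡1+∣p-x∣ x∈p

∣p-x∣≡k : x ∈ p → ∣ p ∣ ≡ suc k → ∣ p - x ∣ ≡ k
∣p-x∣≡k x∈p ∣p∣≡1+k = suc-injective (trans (sym (∣p∣≡1+∣p-x∣ x∈p)) ∣p∣≡1+k)

x∈p⇒∣p∣≢0 : x ∈ p → ∣ p ∣ ≢ 0
x∈p⇒∣p∣≢0 x∈p ∣p∣≡0 = 1+n≢0 (trans (sym (∣p∣≡1+∣p-x∣ x∈p)) ∣p∣≡0)

∣p∣≡1+k⇒Nonempty : ∣ p ∣ ≡ suc k → Nonempty p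
∣p∣≡1+k⇒Nonempty {p = inside ∷ _} _ = zero , here
∣p∣≡1+k⇒Nonempty {p = outside ∷ _} ∣p∣≡1+k with ∣p∣≡1+k⇒Nonempty ∣p∣≡1+k
... | x , x∈p = suc x , there x∈p

∣p∣≡1⇒y≡x : ∣ p ∣ ≡ 1 → x ∈ p → y ∈ p → y ≡ x
∣p∣≡1⇒y≡x {x = x} {y = y} ∣p∣≡1 x∈p y∈p with y ≟ x
... | yes y≡x = y≡x
... | no y≢x = contradiction (∣p-x∣≡k x∈p ∣p∣≡1) (x∈p⇒∣p∣≢0 (x∈p∧x≢y⇒x∈p-y y∈p y≢x))

x∈p∧unique⇒∣p∣≡1 : x ∈ p → (∀ {y} → y ∈ p → y ≡ x) → ∣ p ∣ ≡ 1
x∈p∧unique⇒∣p∣≡1 {x = x} {p = p} x∈p only-x = subst (λ s → ∣ s ∣ ≡ 1) ⁅x⁆≡p (∣⁅x⁆∣≡1 x)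
  where
  ⁅x⁆≡p : ⁅ x ⁆ ≡ p
  ⁅x⁆≡p = ⊆-antisym (λ y∈⁅x⁆ → subst (_∈ p) (sym (x∈⁅y⁆⇒x≡y x y∈⁅x⁆)) x∈p)
                    (λ y∈p → subst (_∈ ⁅ x ⁆) (sym (only-x y∈p)) (x∈⁅x⁆ x))

p⊆q∧∣q∣≤∣p∣⇒p≡q : p ⊆ q → ∣ q ∣ ≤ ∣ p ∣ → p ≡ q
p⊆q∧∣q∣≤∣p∣⇒p≡q {p = p} {q = q} p⊆q ∣q∣≤∣p∣ = ⊆-antisym p⊆q q⊆p
  where
  q⊆p : q ⊆ p
  q⊆p {x} x∈q with x ∈? p
  ... | yes x∈p = x∈p
  ... | no x∉p = contradiction ∣q∣≤∣p∣ (<⇒≱ (p⊂q⇒∣p∣<∣q∣ (p⊆q , x , x∈q , x∉p)))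

∣p∪q∣≡∣p∣+∣q∣ : Disjoint p q → ∣ p ∪ q ∣ ≡ ∣ p ∣ + ∣ q ∣
∣p∪q∣≡∣p∣+∣q∣ {p = []}          {q = []}          _   = refl
∣p∪q∣≡∣p∣+∣q∣ {p = inside ∷ _}  {q = inside ∷ _}  p#q = contradiction here (p#q here)
∣p∪q∣≡∣p∣+∣q∣ {p = inside ∷ _}  {q = outside ∷ _} p#q = cong suc (∣p∪q∣≡∣p∣+∣q∣ (Disjoint-tail p#q))
∣p∪q∣≡∣p∣+∣q∣ {p = outside ∷ p} {q = inside ∷ q}  p#q =
  trans (cong suc (∣p∪q∣≡∣p∣+∣q∣ (Disjoint-tail p#q))) (sym (+-suc ∣ p ∣ ∣ q ∣))
∣p∪q∣≡∣p∣+∣q∣ {p = outside ∷ _} {q = outside ∷ _} p#q = ∣p∪q∣≡∣p∣+∣q∣ (Disjoint-tail p#q)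

IsFreeInvolutionOn : Subset n → (Fin n → Fin n) → Set
IsFreeInvolutionOn Y g = ∀ {x} → x ∈ Y → g x ∈ Y × g x ≢ x × g (g x) ≡ x

IsFreeInvolutionOn-remove : ∀ {Y g} → IsFreeInvolutionOn Y g → x ∈ Y →
                            IsFreeInvolutionOn (Y - x - g x) g
IsFreeInvolutionOn-remove {x = x} {g = g} inv x∈Y {y} y∈Y″ =
  x∈p∧x≢y⇒x∈p-y (x∈p∧x≢y⇒x∈p-y gy∈Y gy≢x) gy≢gx , gy≢y , ggy≡y
  where
  y∈Y′ = p─q⊆p _ _ y∈Y″
  y∈Y = p─q⊆p _ _ y∈Y′
  y≢gx = x∈p-y⇒x≢y y∈Y″
  y≢x = x∈p-y⇒x≢y y∈Y′
  gy∈Y = proj₁ (inv y∈Y)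
  gy≢y = proj₁ (proj₂ (inv y∈Y))
  ggy≡y = proj₂ (proj₂ (inv y∈Y))
  gy≢x : g y ≢ x
  gy≢x gy≡x = y≢gx (trans (sym ggy≡y) (cong g gy≡x))
  gy≢gx : g y ≢ g x
  gy≢gx gy≡gx = y≢x (trans (sym ggy≡y) (trans (cong g gy≡gx) (proj₂ (proj₂ (inv x∈Y)))))

IsFreeInvolutionOn⇒even : ∀ {Y : Subset n} {g} → IsFreeInvolutionOn Y g → 2 ∣ ∣ Y ∣
IsFreeInvolutionOn⇒even inv = even _ refl inv
  where
  even : ∀ {Y g} k → ∣ Y ∣ ≡ k → IsFreeInvolutionOn Y g → 2 ∣ k
  even zero _ _ = 2 ∣0
  even {Y} {g} (suc k) ∣Y∣≡1+k inv = even-after-removal k (∣p-x∣≡k {p = Y} x₀∈Y ∣Y∣≡1+k)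
    where
    x₀ : Fin _
    x₀ = proj₁ (∣p∣≡1+k⇒Nonempty {p = Y} ∣Y∣≡1+k)
    x₀∈Y : x₀ ∈ Y
    x₀∈Y = proj₂ (∣p∣≡1+k⇒Nonempty {p = Y} ∣Y∣≡1+k)
    gx₀∈Y-x : g x₀ ∈ Y - x₀
    gx₀∈Y-x = x∈p∧x≢y⇒x∈p-y (proj₁ (inv x₀∈Y)) (proj₁ (proj₂ (inv x₀∈Y)))
    even-after-removal : ∀ j → ∣ Y - x₀ ∣ ≡ j → 2 ∣ suc j
    even-after-removal zero ∣Y-x₀∣≡0 = contradiction ∣Y-x₀∣≡0 (x∈p⇒∣p∣≢0 gx₀∈Y-x)
    even-after-removal (suc j) ∣Y-x₀∣≡1+j =
      ∣m∣n⇒∣m+n ∣-refl (even j (∣p-x∣≡k gx₀∈Y-x ∣Y-x₀∣≡1+j) (IsFreeInvolutionOn-remove inv x₀∈Y))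

2∣m⇒2∤1+m : ∀ {m} → 2 ∣ m → ¬ 2 ∣ suc m
2∣m⇒2∤1+m {m} 2∣m 2∣1+m with ∣1⇒≡1 (∣m+n∣m⇒∣n (subst (2 ∣_) (+-comm 1 m) 2∣1+m) 2∣m)
... | ()

record Triangle (b : Subset n) (x y z : Fin n) : Set where
  field
    x∈b : x ∈ b
    y∈b : y ∈ b
    z∈b : z ∈ b
    x≢y : x ≢ y
    y≢z : y ≢ z
    z≢x : z ≢ x
    members : ∀ {w} → w ∈ b → w ≡ x ⊎ w ≡ y ⊎ w ≡ z

triangle-rotate : Triangle p x y z → Triangle p y z x
triangle-rotate T = record
  { x∈b = y∈b ; y∈b = z∈b ; z∈b = x∈b ; x≢y = y≢z ; y≢z = z≢x ; z≢x = x≢y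
  ; members = λ w∈b → rotate (members w∈b) }
  where
  open Triangle T
  rotate : ∀ {A B C : Set} → A ⊎ B ⊎ C → B ⊎ C ⊎ A
  rotate (inj₁ a) = inj₂ (inj₂ a)
  rotate (inj₂ (inj₁ b)) = inj₁ b
  rotate (inj₂ (inj₂ c)) = inj₂ (inj₁ c)

triangle-third : Triangle p x y z → w ∈ p → w ≢ x → w ≢ y → w ≡ z
triangle-third T w∈p w≢x w≢y with Triangle.members T w∈p
... | inj₁ w≡x = contradiction w≡x w≢x
... | inj₂ (inj₁ w≡y) = contradiction w≡y w≢y
... | inj₂ (inj₂ w≡z) = w≡z

triangle-⊆ : Triangle p x y z → x ∈ q → y ∈ q → z ∈ q → p ⊆ q
triangle-⊆ T x∈q y∈q z∈q w∈p with Triangle.members T w∈p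
... | inj₁ refl = x∈q
... | inj₂ (inj₁ refl) = y∈q
... | inj₂ (inj₂ refl) = z∈q

triangle : ∣ p ∣ ≡ 3 → x ∈ p → y ∈ p → x ≢ y → ∃ (Triangle p x y)
triangle {p = p} {x = x} {y = y} ∣p∣≡3 x∈p y∈p x≢y = c , record
  { x∈b = x∈p ; y∈b = y∈p ; z∈b = p─q⊆p _ _ (p─q⊆p _ _ c∈p-x-y) ; x≢y = x≢y
  ; y≢z = λ y≡c → x∈p-y⇒x≢y c∈p-x-y (sym y≡c)
  ; z≢x = x∈p-y⇒x≢y (p─q⊆p _ _ c∈p-x-y) ; members = members }
  where
  ∣p-x-y∣≡1 : ∣ p - x - y ∣ ≡ 1
  ∣p-x-y∣≡1 = ∣p-x∣≡k (x∈p∧x≢y⇒x∈p-y y∈p (x≢y ∘ sym)) (∣p-x∣≡k x∈p ∣p∣≡3)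
  c : Fin _
  c = proj₁ (∣p∣≡1+k⇒Nonempty {p = p - x - y} ∣p-x-y∣≡1)
  c∈p-x-y : c ∈ p - x - y
  c∈p-x-y = proj₂ (∣p∣≡1+k⇒Nonempty {p = p - x - y} ∣p-x-y∣≡1)
  members : ∀ {w} → w ∈ p → w ≡ x ⊎ w ≡ y ⊎ w ≡ c
  members {w} w∈p with w ≟ x | w ≟ y
  ... | yes w≡x | _       = inj₁ w≡x
  ... | no _    | yes w≡y = inj₂ (inj₁ w≡y)
  ... | no w≢x  | no w≢y  =
    inj₂ (inj₂ (∣p∣≡1⇒y≡x ∣p-x-y∣≡1 c∈p-x-y (x∈p∧x≢y⇒x∈p-y (x∈p∧x≢y⇒x∈p-y w∈p w≢x) w≢y)))

∣p∣≡3⇒Triangle : ∣ p ∣ ≡ 3 → ∃ λ x → ∃ λ y → ∃ (Triangle p x y)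
∣p∣≡3⇒Triangle {p = p} ∣p∣≡3 = a , b , triangle ∣p∣≡3 a∈p (p─q⊆p _ _ b∈p-a) (x∈p-y⇒x≢y b∈p-a ∘ sym)
  where
  a : Fin _
  a = proj₁ (∣p∣≡1+k⇒Nonempty {p = p} ∣p∣≡3)
  a∈p : a ∈ p
  a∈p = proj₂ (∣p∣≡1+k⇒Nonempty {p = p} ∣p∣≡3)
  b : Fin _
  b = proj₁ (∣p∣≡1+k⇒Nonempty {p = p - a} (∣p-x∣≡k a∈p ∣p∣≡3))
  b∈p-a : b ∈ p - a
  b∈p-a = proj₂ (∣p∣≡1+k⇒Nonempty {p = p - a} (∣p-x∣≡k a∈p ∣p∣≡3))

triangle-meets-once : Triangle p x y z → x ∈ q → y ∉ q → z ∉ q → ∣ p ∩ q ∣ ≡ 1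
triangle-meets-once {p = p} {q = q} T x∈q y∉q z∉q =
  x∈p∧unique⇒∣p∣≡1 (x∈p∩q⁺ (Triangle.x∈b T , x∈q)) only-x
  where
  only-x : ∀ {w} → w ∈ p ∩ q → w ≡ _
  only-x w∈p∩q with x∈p∩q⁻ p q w∈p∩q
  ... | w∈p , w∈q with Triangle.members T w∈p
  ...   | inj₁ w≡x = w≡x
  ...   | inj₂ (inj₁ refl) = contradiction w∈q y∉q
  ...   | inj₂ (inj₂ refl) = contradiction w∈q z∉q

triangle-sides : (G : Fin n → Fin n → Set) → (∀ {u v} → G u v → G v u) → Triangle p x y z →
                 G x y → G y z → G z x → ∀ {u v} → u ∈ p → v ∈ p → u ≢ v → G u v
triangle-sides G G-sym T Gxy Gyz Gzx u∈p v∈p u≢v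
  with Triangle.members T u∈p | Triangle.members T v∈p
... | inj₁ refl        | inj₁ refl        = contradiction refl u≢v
... | inj₁ refl        | inj₂ (inj₁ refl) = Gxy
... | inj₁ refl        | inj₂ (inj₂ refl) = G-sym Gzx
... | inj₂ (inj₁ refl) | inj₁ refl        = G-sym Gxy
... | inj₂ (inj₁ refl) | inj₂ (inj₁ refl) = contradiction refl u≢v
... | inj₂ (inj₁ refl) | inj₂ (inj₂ refl) = Gyz
... | inj₂ (inj₂ refl) | inj₁ refl        = Gzx
... | inj₂ (inj₂ refl) | inj₂ (inj₁ refl) = G-sym Gyz
... | inj₂ (inj₂ refl) | inj₂ (inj₂ refl) = contradiction refl u≢v

Transversal : (A B C : Subset n) → Subset n → Set
Transversal A B C t = ∣ t ∩ A ∣ ≡ 1 × ∣ t ∩ B ∣ ≡ 1 × ∣ t ∩ C ∣ ≡ 1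

transversal : ∀ {A B C t : Subset n} {a b c} → Disjoint A B → Disjoint A C → Disjoint B C →
              ∣ t ∣ ≡ 3 → a ∈ t → b ∈ t → c ∈ t → a ∈ A → b ∈ B → c ∈ C → Transversal A B C t
transversal {t = t} {a} {b} {c} A#B A#C B#C ∣t∣≡3 a∈t b∈t c∈t a∈A b∈B c∈C =
  triangle-meets-once T a∈A (Disjoint-sym A#B b∈B) (Disjoint-sym A#C c∈C) ,
  triangle-meets-once (triangle-rotate T) b∈B (Disjoint-sym B#C c∈C) (A#B a∈A) ,
  triangle-meets-once (triangle-rotate (triangle-rotate T)) c∈C (A#C a∈A) (B#C b∈B)
  where
  ab-triangle : ∃ (Triangle t a b)
  ab-triangle = triangle ∣t∣≡3 a∈t b∈t (Disjoint⇒≢ A#B a∈A b∈B)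
  c≡third : c ≡ proj₁ ab-triangle
  c≡third = triangle-third (proj₂ ab-triangle) c∈t (Disjoint⇒≢ (Disjoint-sym A#C) c∈C a∈A)
                                                   (Disjoint⇒≢ (Disjoint-sym B#C) c∈C b∈B)
  T : Triangle t a b c
  T = subst (Triangle t a b) (sym c≡third) (proj₂ ab-triangle)

record Partition (P Q R D : Subset n) : Set where
  field
    P#Q : Disjoint P Q
    P#R : Disjoint P R
    Q#R : Disjoint Q R
    P#D : Disjoint P D
    Q#D : Disjoint Q D
    R#D : Disjoint R D
    cover : ∀ w → w ∈ P ⊎ w ∈ Q ⊎ w ∈ R ⊎ w ∈ D

IsPartition6663⇒Partition : ∀ {A B C D : Subset n} → IsPartition6663 A B C D → Partition A B C D
IsPartition6663⇒Partition {A = A} {B} {C} {D}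
                          (A∩B , A∩C , A∩D , B∩C , B∩D , C∩D , A∪B∪C∪D≡⊤ , _) = record
  { P#Q = ∩≡⊥⇒Disjoint A∩B ; P#R = ∩≡⊥⇒Disjoint A∩C ; Q#R = ∩≡⊥⇒Disjoint B∩C
  ; P#D = ∩≡⊥⇒Disjoint A∩D ; Q#D = ∩≡⊥⇒Disjoint B∩D ; R#D = ∩≡⊥⇒Disjoint C∩D
  ; cover = λ w → map₂ (map₂ (x∈p∪q⁻ C D) ∘ x∈p∪q⁻ B (C ∪ D))
                       (x∈p∪q⁻ A (B ∪ C ∪ D) (subst (w ∈_) (sym A∪B∪C∪D≡⊤) ∈⊤)) }

partition-swap : ∀ {P Q R D : Subset n} → Partition P Q R D → Partition Q P R D
partition-swap π = record
  { P#Q = Disjoint-sym P#Q ; P#R = Q#R ; Q#R = P#R ; P#D = Q#D ; Q#D = P#D ; R#D = R#D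
  ; cover = swap ∘ cover }
  where
  open Partition π
  swap : ∀ {A B C D : Set} → A ⊎ B ⊎ C ⊎ D → B ⊎ A ⊎ C ⊎ D
  swap (inj₁ a) = inj₂ (inj₁ a)
  swap (inj₂ (inj₁ b)) = inj₁ b
  swap (inj₂ (inj₂ c)) = inj₂ (inj₂ c)

partition-rotate : ∀ {P Q R D : Subset n} → Partition P Q R D → Partition Q R P D
partition-rotate π = record
  { P#Q = Q#R ; P#R = Disjoint-sym P#Q ; Q#R = Disjoint-sym P#R ; P#D = Q#D ; Q#D = R#D ; R#D = P#D
  ; cover = rotate ∘ cover }
  where
  open Partition π
  rotate : ∀ {A B C D : Set} → A ⊎ B ⊎ C ⊎ D → B ⊎ C ⊎ A ⊎ D
  rotate (inj₁ a) = inj₂ (inj₂ (inj₁ a))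
  rotate (inj₂ (inj₁ b)) = inj₁ b
  rotate (inj₂ (inj₂ (inj₁ c))) = inj₂ (inj₁ c)
  rotate (inj₂ (inj₂ (inj₂ d))) = inj₂ (inj₂ (inj₂ d))

module SteinerQuasigroup {n : ℕ} {𝓑 : Family n} (sts : IsSTS n 𝓑) where

  block-size : ∀ {b} → 𝓑 b → ∣ b ∣ ≡ 3
  block-size {b} b∈𝓑 = proj₁ (proj₁ sts b b∈𝓑)

  block-unique : ∀ {x y b c} → x ≢ y → 𝓑 b → x ∈ b → y ∈ b → 𝓑 c → x ∈ c → y ∈ c → b ≡ c
  block-unique x≢y b∈𝓑 x∈b y∈b c∈𝓑 x∈c y∈c =
    let (_ , _ , unique) = proj₂ sts _ _ ∈⊤ ∈⊤ x≢y
    in trans (sym (unique (b∈𝓑 , x∈b , y∈b))) (unique (c∈𝓑 , x∈c , y∈c))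

  private
    through : ∀ {x y} → x ≢ y → ∃ λ b → 𝓑 b × x ∈ b × y ∈ b
    through x≢y = let (b , b∋xy , _) = proj₂ sts _ _ ∈⊤ ∈⊤ x≢y in b , b∋xy

  infixl 7 _·_
  _·_ : Fin n → Fin n → Fin n
  x · y with x ≟ y
  ... | yes _ = x
  ... | no x≢y =
    let (_ , b∈𝓑 , x∈b , y∈b) = through x≢y in proj₁ (triangle (block-size b∈𝓑) x∈b y∈b x≢y)

  line-triangle : ∀ {x y b} → x ≢ y → 𝓑 b → x ∈ b → y ∈ b → Triangle b x y (x · y)
  line-triangle {x} {y} x≢y b∈𝓑 x∈b y∈b with x ≟ y
  ... | yes x≡y = contradiction x≡y x≢y
  ... | no x≢y′ =
    let (c , c∈𝓑 , x∈c , y∈c) = through x≢y′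
    in subst (λ c → Triangle c x y _) (block-unique x≢y′ c∈𝓑 x∈c y∈c b∈𝓑 x∈b y∈b)
             (proj₂ (triangle (block-size c∈𝓑) x∈c y∈c x≢y′))

  line : ∀ {x y} → x ≢ y → ∃ λ b → 𝓑 b × Triangle b x y (x · y)
  line x≢y = let (b , b∈𝓑 , x∈b , y∈b) = through x≢y in b , b∈𝓑 , line-triangle x≢y b∈𝓑 x∈b y∈b

  ·-idem : ∀ x → x · x ≡ x
  ·-idem x with x ≟ x
  ... | yes _ = refl
  ... | no x≢x = contradiction refl x≢x

  ≡⇒·∈ : ∀ {x y X} → x ≡ y → x ∈ X → x · y ∈ X
  ≡⇒·∈ {x} {X = X} refl x∈X = subst (_∈ X) (sym (·-idem x)) x∈X

  ·∈ : ∀ {x y b} → 𝓑 b → x ∈ b → y ∈ b → x · y ∈ b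
  ·∈ {x} {y} b∈𝓑 x∈b y∈b = case x ≟ y of λ where
    (yes x≡y) → ≡⇒·∈ x≡y x∈b
    (no x≢y)  → Triangle.z∈b (line-triangle x≢y b∈𝓑 x∈b y∈b)

  ·-unique : ∀ {x y w b} → x ≢ y → 𝓑 b → x ∈ b → y ∈ b → w ∈ b → w ≢ x → w ≢ y → w ≡ x · y
  ·-unique x≢y b∈𝓑 x∈b y∈b = triangle-third (line-triangle x≢y b∈𝓑 x∈b y∈b)

  ·-comm : ∀ x y → x · y ≡ y · x
  ·-comm x y = case x ≟ y of λ where
    (yes x≡y) → cong₂ _·_ x≡y (sym x≡y)
    (no x≢y)  →
      let (b , b∈𝓑 , T) = line x≢y
          T′ = line-triangle (x≢y ∘ sym) b∈𝓑 (Triangle.y∈b T) (Triangle.x∈b T)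
      in sym (triangle-third T (Triangle.z∈b T′) (Triangle.y≢z T′ ∘ sym) (Triangle.z≢x T′))

  ·-cancel : ∀ x y → x · (x · y) ≡ y
  ·-cancel x y = case x ≟ y of λ where
    (yes x≡y) → subst (λ v → x · (x · v) ≡ v) x≡y (trans (cong (x ·_) (·-idem x)) (·-idem x))
    (no x≢y)  →
      let (b , b∈𝓑 , T) = line x≢y
          T′ = line-triangle (Triangle.z≢x T ∘ sym) b∈𝓑 (Triangle.x∈b T) (Triangle.z∈b T)
      in sym (triangle-third T′ (Triangle.y∈b T) (x≢y ∘ sym) (Triangle.y≢z T))

  ·-solve : ∀ {x y z} → x · y ≡ z → y ≡ x · z
  ·-solve {x} {y} x·y≡z = trans (sym (·-cancel x y)) (cong (x ·_) x·y≡z)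

  ·-cancelˡ : ∀ {x y z} → x · y ≡ x · z → y ≡ z
  ·-cancelˡ {x} {z = z} x·y≡x·z = trans (·-solve {x} x·y≡x·z) (·-cancel x z)

  ·-≢ˡ : ∀ {x y} → x ≢ y → x · y ≢ x
  ·-≢ˡ x≢y = Triangle.z≢x (proj₂ (proj₂ (line x≢y)))

  ·-≢ʳ : ∀ {x y} → x ≢ y → x · y ≢ y
  ·-≢ʳ x≢y = Triangle.y≢z (proj₂ (proj₂ (line x≢y))) ∘ sym

  Restrict : Subset n → Family n
  Restrict X b = 𝓑 b × b ⊆ X

  Closed : Subset n → Set
  Closed X = ∀ {x y} → x ∈ X → y ∈ X → x · y ∈ X

  line-∃! : ∀ {x y} {Q : Subset n → Set} → x ≢ y → (∀ {b} → 𝓑 b → x ∈ b → y ∈ b → Q b) →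
            ∃! _≡_ (λ b → (𝓑 b × Q b) × x ∈ b × y ∈ b)
  line-∃! x≢y on-line =
    let (b , b∈𝓑 , x∈b , y∈b) = through x≢y
    in b , ((b∈𝓑 , on-line b∈𝓑 x∈b y∈b) , x∈b , y∈b) ,
       λ ((c∈𝓑 , _) , x∈c , y∈c) → block-unique x≢y b∈𝓑 x∈b y∈b c∈𝓑 x∈c y∈c

  line-⊆ : ∀ {x y b X} → x ≢ y → 𝓑 b → x ∈ b → y ∈ b → x ∈ X → y ∈ X → x · y ∈ X → b ⊆ X
  line-⊆ x≢y b∈𝓑 x∈b y∈b = triangle-⊆ (line-triangle x≢y b∈𝓑 x∈b y∈b)

  Closed⇒IsSTSOn : ∀ {X} → Closed X → IsSTSOn X (Restrict X)
  Closed⇒IsSTSOn {X} closed =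
    (λ _ (b∈𝓑 , b⊆X) → block-size b∈𝓑 , b⊆X) ,
    λ _ _ x∈X y∈X x≢y →
      line-∃! {Q = _⊆ X} x≢y (λ b∈𝓑 x∈b y∈b → line-⊆ x≢y b∈𝓑 x∈b y∈b x∈X y∈X (closed x∈X y∈X))

  closedOff⇒IsSTSOn : ∀ {X T} → T ⊆ X → ∣ T ∣ ≡ 3 →
    (∀ {x y} → x ∈ X → y ∈ X → x ∉ T → x · y ∈ X) →
    (∀ {d e} → d ∈ T → e ∈ T → d · e ∈ X → d · e ∈ T) →
    IsSTSOn X (λ b → Restrict X b ⊎ b ≡ T)
  closedOff⇒IsSTSOn {X} {T} T⊆X ∣T∣≡3 closed-off T-closed = blocks , pairs
    where
    blocks : ∀ b → Restrict X b ⊎ b ≡ T → ∣ b ∣ ≡ 3 × b ⊆ X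
    blocks _ (inj₁ (b∈𝓑 , b⊆X)) = block-size b∈𝓑 , b⊆X
    blocks _ (inj₂ refl)        = ∣T∣≡3 , T⊆X

    ⊆X⇒≡T : ∀ {x y c} → x ≢ y → 𝓑 c → c ⊆ X → x ∈ c → y ∈ c → x ∈ T → y ∈ T → c ≡ T
    ⊆X⇒≡T x≢y c∈𝓑 c⊆X x∈c y∈c x∈T y∈T =
      p⊆q∧∣q∣≤∣p∣⇒p≡q
        (line-⊆ x≢y c∈𝓑 x∈c y∈c x∈T y∈T (T-closed x∈T y∈T (c⊆X (·∈ c∈𝓑 x∈c y∈c))))
        (≤-reflexive (trans ∣T∣≡3 (sym (block-size c∈𝓑))))

    not-both-in-T : ∀ {x y} → x ≢ y → x ∈ X → y ∈ X → x · y ∈ X → ¬ (x ∈ T × y ∈ T) →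
                    ∃! _≡_ (λ b → (Restrict X b ⊎ b ≡ T) × x ∈ b × y ∈ b)
    not-both-in-T x≢y x∈X y∈X x·y∈X not-both
      with line-∃! {Q = _⊆ X} x≢y (λ b∈𝓑 x∈b y∈b → line-⊆ x≢y b∈𝓑 x∈b y∈b x∈X y∈X x·y∈X)
    ... | b , (b∈R , x∈b , y∈b) , unique = b , (inj₁ b∈R , x∈b , y∈b) , λ where
      (inj₁ c∈R , x∈c , y∈c)  → unique (c∈R , x∈c , y∈c)
      (inj₂ refl , x∈T , y∈T) → contradiction (x∈T , y∈T) not-both

    pairs : ∀ x y → x ∈ X → y ∈ X → x ≢ y → ∃! _≡_ (λ b → (Restrict X b ⊎ b ≡ T) × x ∈ b × y ∈ b)
    pairs x y x∈X y∈X x≢y with x ∈? T | y ∈? T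
    ... | yes x∈T | yes y∈T = T , (inj₂ refl , x∈T , y∈T) , λ where
      (inj₁ (c∈𝓑 , c⊆X) , x∈c , y∈c) → sym (⊆X⇒≡T x≢y c∈𝓑 c⊆X x∈c y∈c x∈T y∈T)
      (inj₂ c≡T , _)                 → sym c≡T
    ... | no x∉T | _ =
      not-both-in-T x≢y x∈X y∈X (closed-off x∈X y∈X x∉T) (x∉T ∘ proj₁)
    ... | yes _ | no y∉T =
      not-both-in-T x≢y x∈X y∈X (subst (_∈ X) (·-comm y x) (closed-off y∈X x∈X y∉T)) (y∉T ∘ proj₂)

  IsSTSOn⇒closedOff : ∀ {X T x y} {𝒞 : Family n} → (∀ b → 𝒞 b → b ≢ T → 𝓑 b) → IsSTSOn X 𝒞 →
                      x ∈ X → y ∈ X → x ∉ T → x · y ∈ X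
  IsSTSOn⇒closedOff {x = x} {y = y} 𝒞∖T⊑𝓑 (blocks , pairs) x∈X y∈X x∉T = case x ≟ y of λ where
    (yes x≡y) → ≡⇒·∈ x≡y x∈X
    (no x≢y)  →
      let (c , (c∈𝒞 , x∈c , y∈c) , _) = pairs x y x∈X y∈X x≢y
          c∈𝓑 = 𝒞∖T⊑𝓑 c c∈𝒞 (λ c≡T → x∉T (subst (x ∈_) c≡T x∈c))
      in proj₂ (blocks c c∈𝒞) (·∈ c∈𝓑 x∈c y∈c)

  PetalClosed : Subset n → Subset n → Set
  PetalClosed P D = ∀ {x y} → x ∈ P → y ∈ P ∪ D → x · y ∈ P ∪ D

  StemIn : Subset n → Subset n → Set
  StemIn P D = ∀ {d e} → d ∈ D → e ∈ D → d · e ∈ P ∪ D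

  ThirdGroup : Subset n → Subset n → Subset n → Set
  ThirdGroup P Q R = ∀ {x y} → x ∈ P → y ∈ Q → x · y ∈ R

  ThirdGroup-swap : ∀ {P Q R} → ThirdGroup P Q R → ThirdGroup Q P R
  ThirdGroup-swap {R = R} PQ⇒R {x} {y} x∈Q y∈P = subst (_∈ R) (·-comm y x) (PQ⇒R y∈P x∈Q)

  PetalClosed-cancel : ∀ {P D x y} → PetalClosed P D → x ∈ P → x · y ∈ P ∪ D → y ∈ P ∪ D
  PetalClosed-cancel {P} {D} {x} {y} closed x∈P x·y∈P∪D =
    subst (_∈ P ∪ D) (·-cancel x y) (closed x∈P x·y∈P∪D)

  subSTS⇒PetalClosed : ∀ {P D} → HasSubSTS9 𝓑 (P ∪ D) → PetalClosed P D
  subSTS⇒PetalClosed {D = D} (_ , _ , 𝒞⊑𝓑 , isSTS) x∈P y∈P∪D =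
    IsSTSOn⇒closedOff {T = ⊥} (λ b b∈𝒞 _ → 𝒞⊑𝓑 b b∈𝒞) isSTS (p⊆p∪q D x∈P) y∈P∪D ∉⊥

  almostSubSTS⇒PetalClosed : ∀ {P D} → Disjoint P D → HasAlmostSubSTS9 𝓑 (P ∪ D) D → PetalClosed P D
  almostSubSTS⇒PetalClosed {D = D} P#D (_ , _ , isSTS , _ , 𝒞∖D⊑𝓑) x∈P y∈P∪D =
    IsSTSOn⇒closedOff 𝒞∖D⊑𝓑 isSTS (p⊆p∪q D x∈P) y∈P∪D (P#D x∈P)

  FlowerShape⇒PetalClosed : ∀ {P Q R D} → Disjoint Q D → Disjoint R D → FlowerShape 𝓑 P Q R D →
                            PetalClosed P D × PetalClosed Q D × PetalClosed R D
  FlowerShape⇒PetalClosed Q#D R#D (sub , almostQ , almostR) =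
    subSTS⇒PetalClosed sub ,
    almostSubSTS⇒PetalClosed Q#D almostQ ,
    almostSubSTS⇒PetalClosed R#D almostR

  PetalClosed∧StemIn⇒Closed : ∀ {P D} → PetalClosed P D → StemIn P D → Closed (P ∪ D)
  PetalClosed∧StemIn⇒Closed {P} {D} closed stem {x} {y} x∈P∪D y∈P∪D
    with x∈p∪q⁻ P D x∈P∪D | x∈p∪q⁻ P D y∈P∪D
  ... | inj₁ x∈P | _        = closed x∈P y∈P∪D
  ... | inj₂ _   | inj₁ y∈P = subst (_∈ P ∪ D) (·-comm y x) (closed y∈P x∈P∪D)
  ... | inj₂ x∈D | inj₂ y∈D = stem x∈D y∈D

  PetalClosed⇒almostSubsystem : ∀ {P D} → ∣ D ∣ ≡ 3 → Disjoint P D → PetalClosed P D →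
    (∀ {d e} → d ∈ D → e ∈ D → d · e ∉ P) → IsSTSOn (P ∪ D) (λ b → Restrict (P ∪ D) b ⊎ b ≡ D)
  PetalClosed⇒almostSubsystem {P} {D} ∣D∣≡3 P#D closed stem-avoids-P =
    closedOff⇒IsSTSOn (q⊆p∪q P D) ∣D∣≡3 off-D stem-in-D
    where
    off-D : ∀ {x y} → x ∈ P ∪ D → y ∈ P ∪ D → x ∉ D → x · y ∈ P ∪ D
    off-D x∈P∪D y∈P∪D x∉D with x∈p∪q⁻ P D x∈P∪D
    ... | inj₁ x∈P = closed x∈P y∈P∪D
    ... | inj₂ x∈D = contradiction x∈D x∉D
    stem-in-D : ∀ {d e} → d ∈ D → e ∈ D → d · e ∈ P ∪ D → d · e ∈ D
    stem-in-D d∈D e∈D d·e∈P∪D with x∈p∪q⁻ P D d·e∈P∪D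
    ... | inj₁ d·e∈P = contradiction d·e∈P (stem-avoids-P d∈D e∈D)
    ... | inj₂ d·e∈D = d·e∈D

  meets-once⇒·∈ : ∀ {t R x y} → 𝓑 t → x ∈ t → y ∈ t → x ≢ y → ∣ t ∩ R ∣ ≡ 1 →
                  x ∉ R → y ∉ R → x · y ∈ R
  meets-once⇒·∈ {t} {R} t∈𝓑 x∈t y∈t x≢y ∣t∩R∣≡1 x∉R y∉R =
    let (r , r∈t∩R) = ∣p∣≡1+k⇒Nonempty {p = t ∩ R} ∣t∩R∣≡1
        (r∈t , r∈R) = x∈p∩q⁻ t R r∈t∩R
    in subst (_∈ R) (·-unique x≢y t∈𝓑 x∈t y∈t r∈t (λ r≡x → x∉R (subst (_∈ R) r≡x r∈R))
                                                 (λ r≡y → y∉R (subst (_∈ R) r≡y r∈R))) r∈R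

  triangle⇒block : ∀ {D x y} → ∣ D ∣ ≡ 3 → Triangle D x y (x · y) → 𝓑 D
  triangle⇒block ∣D∣≡3 T =
    let (b , b∈𝓑 , L) = line (Triangle.x≢y T)
        D⊆b = triangle-⊆ T (Triangle.x∈b L) (Triangle.y∈b L) (Triangle.z∈b L)
        ∣b∣≤∣D∣ = ≤-reflexive (trans (block-size b∈𝓑) (sym ∣D∣≡3))
    in subst 𝓑 (sym (p⊆q∧∣q∣≤∣p∣⇒p≡q D⊆b ∣b∣≤∣D∣)) b∈𝓑

  ·∈D⇒Closed : ∀ {D d₁ d₂ d₃} → ∣ D ∣ ≡ 3 → Triangle D d₁ d₂ d₃ → d₁ · d₂ ∈ D → Closed D
  ·∈D⇒Closed {D} ∣D∣≡3 T d₁·d₂∈D d∈D e∈D = ·∈ D∈𝓑 d∈D e∈D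
    where
    open Triangle T
    D∈𝓑 : 𝓑 D
    D∈𝓑 = triangle⇒block ∣D∣≡3
            (subst (Triangle D _ _) (sym (triangle-third T d₁·d₂∈D (·-≢ˡ x≢y) (·-≢ʳ x≢y))) T)

  ·-involution-on-petal : ∀ {P D d e f} → Disjoint P D → PetalClosed P D → Triangle D d e f →
                          d · f ∉ P → IsFreeInvolutionOn (P - d · e) (d ·_)
  ·-involution-on-petal {P} {D} {d} {e} P#D closed T d·f∉P {x} x∈P-d·e =
    x∈p∧x≢y⇒x∈p-y d·x∈P d·x≢d·e , ·-≢ʳ d≢x , ·-cancel d x
    where
    open Triangle T
    x∈P = p─q⊆p _ _ x∈P-d·e
    d≢x = Disjoint⇒≢ (Disjoint-sym P#D) x∈b x∈P
    d·x≢d·e : d · x ≢ d · e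
    d·x≢d·e d·x≡d·e = P#D x∈P (subst (_∈ D) (sym (·-cancelˡ {d} d·x≡d·e)) y∈b)
    d·x∈P : d · x ∈ P
    d·x∈P with x∈p∪q⁻ P D (subst (_∈ P ∪ D) (·-comm x d) (closed x∈P (q⊆p∪q P D x∈b)))
    ... | inj₁ d·x∈P = d·x∈P
    ... | inj₂ d·x∈D with members d·x∈D
    ...   | inj₁ d·x≡d = contradiction d·x≡d (·-≢ˡ d≢x)
    ...   | inj₂ (inj₁ d·x≡e) = contradiction (·-solve {d} d·x≡e) (x∈p-y⇒x≢y x∈P-d·e)
    ...   | inj₂ (inj₂ d·x≡f) = contradiction (subst (_∈ P) (·-solve {d} d·x≡f) x∈P) d·f∉P

  stem-propagates : ∀ {P D d e f} → Disjoint P D → PetalClosed P D → 2 ∣ ∣ P ∣ →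
                    Triangle D d e f → d · e ∈ P → d · f ∈ P
  stem-propagates {P} {d = d} {f = f} P#D closed ∣P∣-even T d·e∈P with d · f ∈? P
  ... | yes d·f∈P = d·f∈P
  ... | no d·f∉P =
    contradiction (subst (2 ∣_) (∣p∣≡1+∣p-x∣ d·e∈P) ∣P∣-even)
                  (2∣m⇒2∤1+m (IsFreeInvolutionOn⇒even (·-involution-on-petal P#D closed T d·f∉P)))

  stem-in-petal : ∀ {P D d₁ d₂ d₃} → Disjoint P D → PetalClosed P D → 2 ∣ ∣ P ∣ →
                  Triangle D d₁ d₂ d₃ → d₁ · d₂ ∈ P → StemIn P D
  stem-in-petal {P} {D} {d₁} {d₂} {d₃} P#D closed ∣P∣-even T d₁·d₂∈P {d} {e} d∈D e∈D =
    by-cases (d ≟ e)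
    where
    ·∈P-sym : ∀ u v → u · v ∈ P → v · u ∈ P
    ·∈P-sym u v = subst (_∈ P) (·-comm u v)
    d₃·d₁∈P : d₃ · d₁ ∈ P
    d₃·d₁∈P = ·∈P-sym d₁ d₃ (stem-propagates P#D closed ∣P∣-even T d₁·d₂∈P)
    d₂·d₃∈P : d₂ · d₃ ∈ P
    d₂·d₃∈P = ·∈P-sym d₃ d₂
      (stem-propagates P#D closed ∣P∣-even (triangle-rotate (triangle-rotate T)) d₃·d₁∈P)
    by-cases : Dec (d ≡ e) → d · e ∈ P ∪ D
    by-cases (yes d≡e) = ≡⇒·∈ d≡e (q⊆p∪q P D d∈D)
    by-cases (no d≢e)  =
      p⊆p∪q D (triangle-sides (λ u v → u · v ∈ P) (λ {u} {v} → ·∈P-sym u v) T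
                              d₁·d₂∈P d₂·d₃∈P d₃·d₁∈P d∈D e∈D d≢e)

  module _ {P Q R D : Subset n} (π : Partition P Q R D) where
    open Partition π

    private
      P#Q∪D : Disjoint P (Q ∪ D)
      P#Q∪D = Disjoint-∪ P#Q P#D
      Q#P∪D : Disjoint Q (P ∪ D)
      Q#P∪D = Disjoint-∪ (Disjoint-sym P#Q) Q#D
      R#P∪D : Disjoint R (P ∪ D)
      R#P∪D = Disjoint-∪ (Disjoint-sym P#R) R#D

    third-group : PetalClosed P D → PetalClosed Q D → ThirdGroup P Q R
    third-group P-closed Q-closed {x} {y} x∈P y∈Q with cover (x · y)
    ... | inj₁ x·y∈P =
      contradiction (PetalClosed-cancel P-closed x∈P (p⊆p∪q D x·y∈P)) (Q#P∪D y∈Q)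
    ... | inj₂ (inj₁ x·y∈Q) =
      contradiction (PetalClosed-cancel Q-closed y∈Q (p⊆p∪q D (subst (_∈ Q) (·-comm x y) x·y∈Q)))
                    (P#Q∪D x∈P)
    ... | inj₂ (inj₂ (inj₁ x·y∈R)) = x·y∈R
    ... | inj₂ (inj₂ (inj₂ x·y∈D)) =
      contradiction (PetalClosed-cancel P-closed x∈P (q⊆p∪q P D x·y∈D)) (Q#P∪D y∈Q)

    petal-closed : ThirdGroup P Q R → ThirdGroup P R Q → PetalClosed P D
    petal-closed PQ⇒R PR⇒Q {x} {y} x∈P y∈P∪D with cover (x · y)
    ... | inj₁ x·y∈P = p⊆p∪q D x·y∈P
    ... | inj₂ (inj₁ x·y∈Q) =
      contradiction y∈P∪D (R#P∪D (subst (_∈ R) (·-cancel x y) (PQ⇒R x∈P x·y∈Q)))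
    ... | inj₂ (inj₂ (inj₁ x·y∈R)) =
      contradiction y∈P∪D (Q#P∪D (subst (_∈ Q) (·-cancel x y) (PR⇒Q x∈P x·y∈R)))
    ... | inj₂ (inj₂ (inj₂ x·y∈D)) = q⊆p∪q P D x·y∈D

    stem-in-some-petal : PetalClosed P D → PetalClosed Q D → PetalClosed R D →
                         2 ∣ ∣ P ∣ → 2 ∣ ∣ Q ∣ → 2 ∣ ∣ R ∣ → ∣ D ∣ ≡ 3 →
                         StemIn P D ⊎ StemIn Q D ⊎ StemIn R D
    stem-in-some-petal P-closed Q-closed R-closed ∣P∣-even ∣Q∣-even ∣R∣-even ∣D∣≡3
      with ∣p∣≡3⇒Triangle ∣D∣≡3
    ... | d₁ , d₂ , d₃ , T with cover (d₁ · d₂)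
    ...   | inj₁ d₁·d₂∈P = inj₁ (stem-in-petal P#D P-closed ∣P∣-even T d₁·d₂∈P)
    ...   | inj₂ (inj₁ d₁·d₂∈Q) = inj₂ (inj₁ (stem-in-petal Q#D Q-closed ∣Q∣-even T d₁·d₂∈Q))
    ...   | inj₂ (inj₂ (inj₁ d₁·d₂∈R)) = inj₂ (inj₂ (stem-in-petal R#D R-closed ∣R∣-even T d₁·d₂∈R))
    ...   | inj₂ (inj₂ (inj₂ d₁·d₂∈D)) =
      inj₁ (λ d∈D e∈D → q⊆p∪q P D (·∈D⇒Closed ∣D∣≡3 T d₁·d₂∈D d∈D e∈D))

    flower-shape : ∣ P ∣ ≡ 6 → ∣ Q ∣ ≡ 6 → ∣ R ∣ ≡ 6 → ∣ D ∣ ≡ 3 →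
                   PetalClosed P D → PetalClosed Q D → PetalClosed R D → StemIn P D →
                   FlowerShape 𝓑 P Q R D
    flower-shape ∣P∣≡6 ∣Q∣≡6 ∣R∣≡6 ∣D∣≡3 P-closed Q-closed R-closed stem =
      (∣∪D∣≡9 P#D ∣P∣≡6 , Restrict (P ∪ D) , (λ _ → proj₁) ,
       Closed⇒IsSTSOn (PetalClosed∧StemIn⇒Closed P-closed stem)) ,
      almost-sub-STS Q#D (Disjoint-sym P#Q) ∣Q∣≡6 Q-closed ,
      almost-sub-STS R#D (Disjoint-sym P#R) ∣R∣≡6 R-closed
      where
      ∣∪D∣≡9 : ∀ {X} → Disjoint X D → ∣ X ∣ ≡ 6 → ∣ X ∪ D ∣ ≡ 9
      ∣∪D∣≡9 X#D ∣X∣≡6 = trans (∣p∪q∣≡∣p∣+∣q∣ X#D) (cong₂ _+_ ∣X∣≡6 ∣D∣≡3)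
      almost-sub-STS : ∀ {X} → Disjoint X D → Disjoint X P → ∣ X ∣ ≡ 6 → PetalClosed X D →
                       HasAlmostSubSTS9 𝓑 (X ∪ D) D
      almost-sub-STS X#D X#P ∣X∣≡6 X-closed =
        ∣∪D∣≡9 X#D ∣X∣≡6 , _ ,
        PetalClosed⇒almostSubsystem ∣D∣≡3 X#D X-closed
          (λ d∈D e∈D d·e∈X → Disjoint-∪ X#P X#D d·e∈X (stem d∈D e∈D)) ,
        inj₂ refl , λ where
          _ (inj₁ (b∈𝓑 , _)) _   → b∈𝓑
          _ (inj₂ b≡D)       b≢D → contradiction b≡D b≢D

module FlowerCriterion {n : ℕ} {𝓑 : Family n} (sts : IsSTS n 𝓑)
                       {A B C D : Subset n} (π : Partition A B C D)
                       (∣A∣≡6 : ∣ A ∣ ≡ 6) (∣B∣≡6 : ∣ B ∣ ≡ 6) (∣C∣≡6 : ∣ C ∣ ≡ 6)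
                       (∣D∣≡3 : ∣ D ∣ ≡ 3) where

  open SteinerQuasigroup sts
  open Partition π renaming (P#Q to A#B; P#R to A#C; Q#R to B#C; P#D to A#D; Q#D to B#D; R#D to C#D)

  private
    π-BCA : Partition B C A D
    π-BCA = partition-rotate π
    π-CAB : Partition C A B D
    π-CAB = partition-rotate π-BCA
    π-ACB : Partition A C B D
    π-ACB = partition-swap π-CAB
    π-BAC : Partition B A C D
    π-BAC = partition-swap π

    ∣X∣≡6⇒even : ∀ (X : Subset n) → ∣ X ∣ ≡ 6 → 2 ∣ ∣ X ∣
    ∣X∣≡6⇒even _ ∣X∣≡6 = subst (2 ∣_) (sym ∣X∣≡6) (divides 3 refl)

  Petals : Set
  Petals = PetalClosed A D × PetalClosed B D × PetalClosed C D

  Crossing : Set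
  Crossing = ThirdGroup A B C × ThirdGroup A C B × ThirdGroup B C A

  IsFlower⇒Petals : IsFlower 𝓑 A B C D → Petals
  IsFlower⇒Petals (inj₁ shape) = FlowerShape⇒PetalClosed B#D C#D shape
  IsFlower⇒Petals (inj₂ (inj₁ shape)) =
    let (B-closed , A-closed , C-closed) = FlowerShape⇒PetalClosed A#D C#D shape
    in A-closed , B-closed , C-closed
  IsFlower⇒Petals (inj₂ (inj₂ shape)) =
    let (C-closed , A-closed , B-closed) = FlowerShape⇒PetalClosed A#D B#D shape
    in A-closed , B-closed , C-closed

  Petals⇒IsFlower : Petals → IsFlower 𝓑 A B C D
  Petals⇒IsFlower (A-closed , B-closed , C-closed)
    with stem-in-some-petal π A-closed B-closed C-closed
           (∣X∣≡6⇒even A ∣A∣≡6) (∣X∣≡6⇒even B ∣B∣≡6) (∣X∣≡6⇒even C ∣C∣≡6) ∣D∣≡3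
  ... | inj₁ stem =
    inj₁ (flower-shape π ∣A∣≡6 ∣B∣≡6 ∣C∣≡6 ∣D∣≡3 A-closed B-closed C-closed stem)
  ... | inj₂ (inj₁ stem) =
    inj₂ (inj₁ (flower-shape π-BAC ∣B∣≡6 ∣A∣≡6 ∣C∣≡6 ∣D∣≡3 B-closed A-closed C-closed stem))
  ... | inj₂ (inj₂ stem) =
    inj₂ (inj₂ (flower-shape π-CAB ∣C∣≡6 ∣A∣≡6 ∣B∣≡6 ∣D∣≡3 C-closed A-closed B-closed stem))

  Petals⇒Crossing : Petals → Crossing
  Petals⇒Crossing (A-closed , B-closed , C-closed) =
    third-group π A-closed B-closed ,
    third-group π-ACB A-closed C-closed ,
    third-group π-BCA B-closed C-closed

  Crossing⇒Petals : Crossing → Petals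
  Crossing⇒Petals (AB⇒C , AC⇒B , BC⇒A) =
    petal-closed π AB⇒C AC⇒B ,
    petal-closed π-BCA BC⇒A (ThirdGroup-swap AB⇒C) ,
    petal-closed π-CAB (ThirdGroup-swap AC⇒B) (ThirdGroup-swap BC⇒A)

  DiffGroups⇒≢ : ∀ {x y} → DiffGroups A B C x y → x ≢ y
  DiffGroups⇒≢ (inj₁ (x∈A , y∈B)) = Disjoint⇒≢ A#B x∈A y∈B
  DiffGroups⇒≢ (inj₂ (inj₁ (x∈B , y∈A))) = Disjoint⇒≢ (Disjoint-sym A#B) x∈B y∈A
  DiffGroups⇒≢ (inj₂ (inj₂ (inj₁ (x∈A , y∈C)))) = Disjoint⇒≢ A#C x∈A y∈C
  DiffGroups⇒≢ (inj₂ (inj₂ (inj₂ (inj₁ (x∈C , y∈A))))) = Disjoint⇒≢ (Disjoint-sym A#C) x∈C y∈A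
  DiffGroups⇒≢ (inj₂ (inj₂ (inj₂ (inj₂ (inj₁ (x∈B , y∈C)))))) = Disjoint⇒≢ B#C x∈B y∈C
  DiffGroups⇒≢ (inj₂ (inj₂ (inj₂ (inj₂ (inj₂ (x∈C , y∈B)))))) = Disjoint⇒≢ (Disjoint-sym B#C) x∈C y∈B

  Crossing⇒Transversal : ∀ {x y t} → Crossing → DiffGroups A B C x y → 𝓑 t → x ∈ t → y ∈ t →
                         Transversal A B C t
  Crossing⇒Transversal {x} {y} {t} (AB⇒C , AC⇒B , BC⇒A) groups t∈𝓑 x∈t y∈t = by-groups groups
    where
    x·y∈t : x · y ∈ t
    x·y∈t = ·∈ t∈𝓑 x∈t y∈t
    meets-ABC : ∀ {a b c} → a ∈ t → b ∈ t → c ∈ t → a ∈ A → b ∈ B → c ∈ C → Transversal A B C t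
    meets-ABC = transversal A#B A#C B#C (block-size t∈𝓑)
    by-groups : DiffGroups A B C x y → Transversal A B C t
    by-groups (inj₁ (x∈A , y∈B)) =
      meets-ABC x∈t y∈t x·y∈t x∈A y∈B (AB⇒C x∈A y∈B)
    by-groups (inj₂ (inj₁ (x∈B , y∈A))) =
      meets-ABC y∈t x∈t x·y∈t y∈A x∈B (ThirdGroup-swap AB⇒C x∈B y∈A)
    by-groups (inj₂ (inj₂ (inj₁ (x∈A , y∈C)))) =
      meets-ABC x∈t x·y∈t y∈t x∈A (AC⇒B x∈A y∈C) y∈C
    by-groups (inj₂ (inj₂ (inj₂ (inj₁ (x∈C , y∈A))))) =
      meets-ABC y∈t x·y∈t x∈t y∈A (ThirdGroup-swap AC⇒B x∈C y∈A) x∈C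
    by-groups (inj₂ (inj₂ (inj₂ (inj₂ (inj₁ (x∈B , y∈C)))))) =
      meets-ABC x·y∈t x∈t y∈t (BC⇒A x∈B y∈C) x∈B y∈C
    by-groups (inj₂ (inj₂ (inj₂ (inj₂ (inj₂ (x∈C , y∈B)))))) =
      meets-ABC x·y∈t y∈t x∈t (ThirdGroup-swap BC⇒A x∈C y∈B) y∈B x∈C

  Crossing⇒HasSubTD36 : Crossing → HasSubTD36 𝓑 A B C
  Crossing⇒HasSubTD36 crossing =
    (λ t → 𝓑 t × Transversal A B C t) , (λ _ → proj₁) ,
    ∣A∣≡6 , ∣B∣≡6 , ∣C∣≡6 , Disjoint⇒∩≡⊥ A#B , Disjoint⇒∩≡⊥ A#C , Disjoint⇒∩≡⊥ B#C ,
    (λ _ (t∈𝓑 , t-transversal) → block-size t∈𝓑 , t-transversal) ,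
    λ _ _ groups → line-∃! (DiffGroups⇒≢ groups) (Crossing⇒Transversal crossing groups)

  HasSubTD36⇒Crossing : HasSubTD36 𝓑 A B C → Crossing
  HasSubTD36⇒Crossing (_ , 𝒯⊑𝓑 , _ , _ , _ , _ , _ , _ , blocks , pairs) =
    (λ x∈A y∈B → third-point (inj₁ (x∈A , y∈B)) (λ (_ , _ , c) → c) (A#C x∈A) (B#C y∈B)) ,
    (λ x∈A y∈C → third-point (inj₂ (inj₂ (inj₁ (x∈A , y∈C)))) (λ (_ , b , _) → b)
                             (A#B x∈A) (Disjoint-sym B#C y∈C)) ,
    (λ x∈B y∈C → third-point (inj₂ (inj₂ (inj₂ (inj₂ (inj₁ (x∈B , y∈C)))))) (λ (a , _ , _) → a)
                             (Disjoint-sym A#B x∈B) (Disjoint-sym A#C y∈C))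
    where
    third-point : ∀ {x y R} → DiffGroups A B C x y → (∀ {t} → Transversal A B C t → ∣ t ∩ R ∣ ≡ 1) →
                  x ∉ R → y ∉ R → x · y ∈ R
    third-point {x} {y} groups meets-R x∉R y∉R =
      let (t , (t∈𝒯 , x∈t , y∈t) , _) = pairs x y groups
      in meets-once⇒·∈ (𝒯⊑𝓑 t t∈𝒯) x∈t y∈t (DiffGroups⇒≢ groups)
                       (meets-R {t} (proj₂ (blocks t t∈𝒯))) x∉R y∉R

lemma3 : (𝓑 : Family 21) → IsSTS 21 𝓑 →
         (A B C D : Subset 21) → IsPartition6663 A B C D →
         IsFlower 𝓑 A B C D ⇔ HasSubTD36 𝓑 A B C
lemma3 𝓑 sts A B C D partition@(_ , _ , _ , _ , _ , _ , _ , ∣A∣≡6 , ∣B∣≡6 , ∣C∣≡6 , ∣D∣≡3) =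
  mk⇔ (Crossing⇒HasSubTD36 ∘ Petals⇒Crossing ∘ IsFlower⇒Petals)
      (Petals⇒IsFlower ∘ Crossing⇒Petals ∘ HasSubTD36⇒Crossing)
  where
  open FlowerCriterion sts (IsPartition6663⇒Partition partition) ∣A∣≡6 ∣B∣≡6 ∣C∣≡6 ∣D∣≡3
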